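{- Consider an agreeable instance of $1|(p,p,b_j)|L_{\max}$ and let $T$ be the set of jobs $j$ with $b_j>p$. Without loss of generality (i.e. there is an optimal schedule in which this holds), no singleton job $i\in T$ is immediately followed by a singleton job $j\notin T$.
   Context: Problem $1|(p,p,b_j)|L_{\max}$: $n$ jobs on a single machine (at most one task at a time, no preemption). Job $j$ has a first task of length $p>0$ and a second task of length $b_j\ge 0$ which must start exactly $p$ time units after the first task completes; job $j$ has due date $d_j$, completion time $C_j$ (completion of its second task) and lateness $L_j=C_j-d_j$; the objective is to minimize $L_{\max}=\max_j L_j$. Agreeable: jobs are indexed so that $d_1\le\dots\le d_n$ and $b_1\le\dots\le b_n$. An (ordered) interlaced pair $(i,j)$ started at time $t$ means job $i$ starts at $t$ and job $j$ starts at $t+p$ (requires $b_i\le p$); then $C_i=t+2p+b_i$, $C_j=t+3p+b_j$. A singleton is a job not interlaced with any other, occupying $[t,t+2p+b_i]$ when started at $t$. Schedules are sequences of pairs and singletons, each unit starting when the previous one completes. -}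

module Defs where

open import Data.Nat using (ℕ; zero; suc; _+_; _≤_; _<_)
open import Data.Fin using (Fin; _≟_) renaming (_≤_ to _≤ᶠ_)
open import Data.List using (List; []; _∷_; _++_; allFin)
open import Data.List.Relation.Binary.Permutation.Propositional using (_↭_)
open import Data.List.Relation.Unary.All using (All)
open import Data.Product using (Σ; _×_; ∃; ∃-syntax)
open import Relation.Nullary using (yes; no)
open import Relation.Binary.PropositionalEquality using (_≡_)

record Instance (n : ℕ) : Set where
  field
    p   : ℕ
    p>0 : 0 < p
    b   : Fin n → ℕ
    d   : Fin n → ℕ

open Instance public

Agreeable : ∀ {n} → Instance n → Set
Agreeable {n} I = (i j : Fin n) → i ≤ᶠ j → (d I i ≤ d I j) × (b I i ≤ b I j)

-- A scheduling unit: a singleton job, or an ordered interlaced pair (i , j)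
-- (job i starts at t, job j starts at t + p).
data Unit (n : ℕ) : Set where
  single : Fin n → Unit n
  pair   : Fin n → Fin n → Unit n

-- A schedule is a sequence of units, each starting when the previous completes,
-- the first one at time 0.
Schedule : ℕ → Set
Schedule n = List (Unit n)

jobsOf : ∀ {n} → Schedule n → List (Fin n)
jobsOf [] = []
jobsOf (single i ∷ us) = i ∷ jobsOf us
jobsOf (pair i j ∷ us) = i ∷ j ∷ jobsOf us

UnitOK : ∀ {n} → Instance n → Unit n → Set
UnitOK I (single i) = Data.Unit.⊤ where import Data.Unit
UnitOK I (pair i j) = b I i ≤ p I

Feasible : ∀ {n} → Instance n → Schedule n → Set
Feasible {n} I σ = (jobsOf σ ↭ allFin n) × All (UnitOK I) σ

-- length of a unit (time from its start until it completes)
-- singleton: 2p + b_i ; pair (i,j) with b_i ≤ p: completes at t + 3p + b_j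
unitLen : ∀ {n} → Instance n → Unit n → ℕ
unitLen I (single i) = p I + p I + b I i
unitLen I (pair i j) = p I + p I + p I + b I j

-- completion time of job k in the schedule whose first unit starts at time t
-- (0 if k does not occur; irrelevant for feasible schedules)
compFrom : ∀ {n} → Instance n → ℕ → Schedule n → Fin n → ℕ
compFrom I t [] k = 0
compFrom I t (single i ∷ us) k with i ≟ k
... | yes _ = t + p I + p I + b I i
... | no  _ = compFrom I (t + unitLen I (single i)) us k
compFrom I t (pair i j ∷ us) k with i ≟ k | j ≟ k
... | yes _ | _     = t + p I + p I + b I i
... | no _  | yes _ = t + p I + p I + p I + b I j
... | no _  | no _  = compFrom I (t + unitLen I (pair i j)) us k

C : ∀ {n} → Instance n → Schedule n → Fin n → ℕ
C I σ = compFrom I 0 σ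

-- Lmax(σ) ≤ Lmax(σ'):  for every job j there is a job k with
-- C_j(σ) - d_j ≤ C_k(σ') - d_k   (written without subtraction in ℕ).
LmaxLE : ∀ {n} → Instance n → Schedule n → Schedule n → Set
LmaxLE {n} I σ σ' = (j : Fin n) → ∃[ k ] (C I σ j + d I k ≤ C I σ' k + d I j)

Optimal : ∀ {n} → Instance n → Schedule n → Set
Optimal I σ = Feasible I σ × (∀ σ' → Feasible I σ' → LmaxLE I σ σ')

SingletonFollowedBy : ∀ {n} → Schedule n → Fin n → Fin n → Set
SingletonFollowedBy σ i j = ∃[ xs ] ∃[ ys ] (σ ≡ xs ++ single i ∷ single j ∷ ys)

InT : ∀ {n} → Instance n → Fin n → Set
InT I j = p I < b I j

{-# OPTIONS --safe #-}
-- Among the optimal schedules take one with the fewest units. If in it a singleton i with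
-- b_i > p were immediately followed by a singleton j with b_j ≤ p, we could start j first
-- and interlace i into it. The pair (j , i) ends earlier than the two singletons, so no
-- other job is delayed, and i now completes before j used to; as b_j < b_i, agreeability
-- gives d_j ≤ d_i, so L_i stays below the old L_j. The result is still optimal but has one
-- unit fewer. Optimal schedules exist since feasible ones have at most n units and can
-- therefore be enumerated.
module Submission where

open import Defs
open import Data.Nat using (ℕ; zero; suc; _+_; _∸_; _≤_; _<_; z≤n; s≤s; _≤?_; _<?_)
open import Data.Nat.Properties
  using ( ≤-refl; ≤-reflexive; ≤-trans; ≤-<-trans; <⇒≢; <⇒≱; ≮⇒≥; m≤m+n; m≤n⇒m≤1+n; n<1+n
        ; m∸n+n≡m; ∸-monoʳ-≤; +-identityʳ; +-comm; +-assoc; +-monoˡ-≤; +-mono-≤; +-monoʳ-<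
        ; +-cancelʳ-≤; module ≤-Reasoning)
open import Data.Nat.ListAction using (sum)
open import Data.Nat.Tactic.RingSolver using (solve-∀)
open import Data.Fin using (Fin; _≟_)
import Data.Fin.Properties as Fin
open import Data.List
  using (List; []; _∷_; [_]; _++_; map; filter; allFin; length; cartesianProductWith)
open import Data.List.Properties using (≡-dec; length-++; length-tabulate)
open import Data.List.Extrema.Nat
  using (argmin; argmin-all; f[argmin]≤f[xs]; max; xs≤max; max≤v⁺; argmax-sel)
open import Data.List.Membership.Propositional using (_∈_; _∉_)
open import Data.List.Membership.Propositional.Properties
  using (∈-++⁺ˡ; ∈-++⁺ʳ; ∈-map⁺; ∈-map⁻; ∈-allFin; ∈-cartesianProductWith⁺; ∈-filter⁺)
open import Data.List.Relation.Binary.Permutation.Propositional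
  using (_↭_; ↭-refl; ↭-sym; ↭-trans; ↭-reflexive; swap; ↭⇒↭ₛ)
open import Data.List.Relation.Binary.Permutation.Propositional.Properties
  using (↭-length; ++⁺ˡ; ++⁺ʳ)
import Data.List.Relation.Binary.Permutation.Setoid.Properties as Permutationₛ
open import Data.List.Relation.Binary.Pointwise using (Pointwise-≡⇒≡)
open import Data.List.Relation.Unary.All as All using (All; []; _∷_; all?)
import Data.List.Relation.Unary.All.Properties as All
open import Data.List.Relation.Unary.AllPairs using (_∷_)
open import Data.List.Relation.Unary.Any using (here; there)
open import Data.List.Relation.Unary.Sorted.TotalOrder.Properties using (↗↭↗⇒≋)
open import Data.List.Relation.Unary.Unique.Propositional using (Unique)
open import Data.List.Relation.Unary.Unique.Propositional.Properties using (allFin⁺)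
open import Data.Product using (_×_; _,_; proj₁; proj₂; ∃-syntax)
open import Data.Sum using (inj₁; inj₂)
open import Data.Unit using (tt)
open import Function using (_∘_)
open import Level using (0ℓ)
open import Relation.Nullary using (Dec; yes; no; contradiction)
open import Relation.Nullary.Decidable using (map′; _×-dec_)
open import Relation.Unary using (Pred; Decidable)
open import Relation.Binary.PropositionalEquality
  using (_≡_; _≢_; refl; sym; trans; cong; subst; subst₂; setoid; module ≡-Reasoning)

+-exchange : ∀ {a b u v x y} → u + x ≡ v + y → a + u ≤ b + v → a + y ≤ b + x
+-exchange {a} {b} {u} {v} {x} {y} u+x≡v+y a+u≤b+v = +-cancelʳ-≤ (u + x) (a + y) (b + x) (begin
  a + y + (u + x) ≡⟨ regroup a y u x ⟩
  a + u + (x + y) ≤⟨ +-monoˡ-≤ (x + y) a+u≤b+v ⟩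
  b + v + (x + y) ≡⟨ regroup b v x y ⟩
  b + x + (y + v) ≡⟨ cong (b + x +_) (trans (+-comm y v) (sym u+x≡v+y)) ⟩
  b + x + (u + x) ∎)
  where
  open ≤-Reasoning
  regroup : ∀ a b c d → a + b + (c + d) ≡ a + c + (d + b)
  regroup = solve-∀

Unique-++⇒∉ : ∀ {A : Set} (xs : List A) {ys y} → Unique (xs ++ ys) → y ∈ ys → y ∉ xs
Unique-++⇒∉ (x ∷ xs) (x∉ ∷ _) y∈ys (here refl) = All.lookup x∉ (∈-++⁺ʳ xs y∈ys) refl
Unique-++⇒∉ (x ∷ xs) (_ ∷ u)  y∈ys (there y∈xs) = Unique-++⇒∉ xs u y∈ys y∈xs

module _ {A : Set} (xs : List A) where

  listsUpTo : ℕ → List (List A)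
  listsUpTo zero    = [ [] ]
  listsUpTo (suc m) = [] ∷ cartesianProductWith _∷_ xs (listsUpTo m)

  ∈-listsUpTo : ∀ {m ys} → All (_∈ xs) ys → length ys ≤ m → ys ∈ listsUpTo m
  ∈-listsUpTo {zero}  []           _            = here refl
  ∈-listsUpTo {suc m} []           _            = here refl
  ∈-listsUpTo {suc m} (y∈ ∷ ys∈xs) (s≤s len≤m) =
    there (∈-cartesianProductWith⁺ _∷_ y∈ (∈-listsUpTo ys∈xs len≤m))

∃-argmin : ∀ {A : Set} {P : Pred A 0ℓ} → Decidable P → (key : A → ℕ) (xs : List A) →
           (∀ {a} → P a → a ∈ xs) → ∀ {a₀} → P a₀ →
           ∃[ m ] (P m × (∀ {a} → P a → key m ≤ key a))
∃-argmin P? key xs complete {a₀} Pa₀ =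
    argmin key a₀ candidates
  , argmin-all key Pa₀ (All.all-filter P? xs)
  , λ Pa → All.lookup (f[argmin]≤f[xs] a₀ candidates) (∈-filter⁺ P? (complete Pa) Pa)
  where candidates = filter P? xs

module _ {n : ℕ} where

  open import Data.List.Sort (Fin.≤-decTotalOrder n) using (sort; sort-↭; sort-↗)

  _↭?_ : (xs ys : List (Fin n)) → Dec (xs ↭ ys)
  xs ↭? ys = map′ sort≡⇒↭ ↭⇒sort≡ (≡-dec _≟_ (sort xs) (sort ys))
    where
    ↭⇒sort≡ : xs ↭ ys → sort xs ≡ sort ys
    ↭⇒sort≡ xs↭ys = Pointwise-≡⇒≡ (↗↭↗⇒≋ (Fin.≤-totalOrder n) (sort-↗ xs) (sort-↗ ys)
      (↭⇒↭ₛ (↭-trans (sort-↭ xs) (↭-trans xs↭ys (↭-sym (sort-↭ ys))))))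
    sort≡⇒↭ : sort xs ≡ sort ys → xs ↭ ys
    sort≡⇒↭ eq = ↭-trans (↭-sym (sort-↭ xs)) (↭-trans (↭-reflexive eq) (sort-↭ ys))

  maxᶠ : (Fin n → ℕ) → ℕ
  maxᶠ f = max 0 (map f (allFin n))

  f≤maxᶠ : ∀ f k → f k ≤ maxᶠ f
  f≤maxᶠ f k = All.lookup (xs≤max 0 (map f (allFin n))) (∈-map⁺ f (∈-allFin k))

  maxᶠ≤ : ∀ {f m} → (∀ k → f k ≤ m) → maxᶠ f ≤ m
  maxᶠ≤ f≤m = max≤v⁺ z≤n (All.map⁺ (All.tabulate⁺ f≤m))

  maxᶠ-attained : ∀ f → Fin n → ∃[ k ] (maxᶠ f ≤ f k)
  maxᶠ-attained f j with argmax-sel (λ x → x) 0 (map f (allFin n))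
  ... | inj₁ max≡0 = j , subst (_≤ f j) (sym max≡0) z≤n
  ... | inj₂ max∈  with ∈-map⁻ f max∈
  ...   | k , _ , max≡fk = k , subst (_≤ f k) (sym max≡fk) ≤-refl

pair-ends-earlier : ∀ t p a c → t + (p + p + p + a) ≤ t + (p + p + a) + (p + p + c)
pair-ends-earlier t p a c = subst (t + (p + p + p + a) ≤_) (regroup t p a c) (m≤m+n _ (p + c))
  where
  regroup : ∀ t p a c → t + (p + p + p + a) + (p + c) ≡ t + (p + p + a) + (p + p + c)
  regroup = solve-∀

pair-snd-ends-earlier : ∀ t p a c → t + p + p + p + a ≤ t + (p + p + a) + p + p + c
pair-snd-ends-earlier t p a c = subst (t + p + p + p + a ≤_) (regroup t p a c) (m≤m+n _ (p + c))
  where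
  regroup : ∀ t p a c → t + p + p + p + a + (p + c) ≡ t + (p + p + a) + p + p + c
  regroup = solve-∀

jobsOf-++ : ∀ {n} (xs ys : Schedule n) → jobsOf (xs ++ ys) ≡ jobsOf xs ++ jobsOf ys
jobsOf-++ []              ys = refl
jobsOf-++ (single i ∷ xs) ys = cong (i ∷_) (jobsOf-++ xs ys)
jobsOf-++ (pair i j ∷ xs) ys = cong (λ ks → i ∷ j ∷ ks) (jobsOf-++ xs ys)

jobsOf-map-single : ∀ {n} (ks : List (Fin n)) → jobsOf (map single ks) ≡ ks
jobsOf-map-single []       = refl
jobsOf-map-single (k ∷ ks) = cong (k ∷_) (jobsOf-map-single ks)

length≤length-jobsOf : ∀ {n} (σ : Schedule n) → length σ ≤ length (jobsOf σ)
length≤length-jobsOf []             = z≤n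
length≤length-jobsOf (single _ ∷ σ) = s≤s (length≤length-jobsOf σ)
length≤length-jobsOf (pair _ _ ∷ σ) = s≤s (m≤n⇒m≤1+n (length≤length-jobsOf σ))

module _ {n : ℕ} where

  units : List (Unit n)
  units = map single (allFin n) ++ cartesianProductWith pair (allFin n) (allFin n)

  ∈-units : ∀ u → u ∈ units
  ∈-units (single i) = ∈-++⁺ˡ (∈-map⁺ single (∈-allFin i))
  ∈-units (pair i j) =
    ∈-++⁺ʳ (map single (allFin n)) (∈-cartesianProductWith⁺ pair (∈-allFin i) (∈-allFin j))

  schedules : List (Schedule n)
  schedules = listsUpTo units n

module _ {n : ℕ} (I : Instance n) where

  open import Data.List.Membership.DecPropositional (_≟_ {n}) using (_∈?_)

  compFrom-skip : ∀ u {us k t} → k ∉ jobsOf [ u ] →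
                  compFrom I t (u ∷ us) k ≡ compFrom I (t + unitLen I u) us k
  compFrom-skip (single i) {k = k} k∉ with i ≟ k
  ... | yes refl = contradiction (here refl) k∉
  ... | no  _    = refl
  compFrom-skip (pair i j) {k = k} k∉ with i ≟ k | j ≟ k
  ... | yes refl | _        = contradiction (here refl) k∉
  ... | no  _    | yes refl = contradiction (there (here refl)) k∉
  ... | no  _    | no  _    = refl

  compFrom-tail-irrelevant : ∀ u {us vs k t} → k ∈ jobsOf [ u ] →
                             compFrom I t (u ∷ us) k ≡ compFrom I t (u ∷ vs) k
  compFrom-tail-irrelevant (single i) (here refl) with i ≟ i
  ... | yes _   = refl
  ... | no  i≢i = contradiction refl i≢i
  compFrom-tail-irrelevant (pair i j) (here refl) with i ≟ i
  ... | yes _   = refl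
  ... | no  i≢i = contradiction refl i≢i
  compFrom-tail-irrelevant (pair i j) (there (here refl)) with i ≟ j | j ≟ j
  ... | yes _ | _       = refl
  ... | no  _ | yes _   = refl
  ... | no  _ | no  j≢j = contradiction refl j≢j

  compFrom-mono : ∀ us k {t t'} → t ≤ t' → compFrom I t us k ≤ compFrom I t' us k
  compFrom-mono []              k t≤t' = ≤-refl
  compFrom-mono (single i ∷ us) k t≤t' with i ≟ k
  ... | yes _ = +-monoˡ-≤ _ (+-monoˡ-≤ _ (+-monoˡ-≤ _ t≤t'))
  ... | no  _ = compFrom-mono us k (+-monoˡ-≤ _ t≤t')
  compFrom-mono (pair i j ∷ us) k t≤t' with i ≟ k | j ≟ k
  ... | yes _ | _     = +-monoˡ-≤ _ (+-monoˡ-≤ _ (+-monoˡ-≤ _ t≤t'))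
  ... | no  _ | yes _ = +-monoˡ-≤ _ (+-monoˡ-≤ _ (+-monoˡ-≤ _ (+-monoˡ-≤ _ t≤t')))
  ... | no  _ | no  _ = compFrom-mono us k (+-monoˡ-≤ _ t≤t')

  compFrom-++-mono : ∀ {us vs k} → (∀ t → compFrom I t us k ≤ compFrom I t vs k) →
                     ∀ xs t → compFrom I t (xs ++ us) k ≤ compFrom I t (xs ++ vs) k
  compFrom-++-mono us≤vs []       t = us≤vs t
  compFrom-++-mono {k = k} us≤vs (u ∷ xs) t with k ∈? jobsOf [ u ]
  ... | yes k∈u = ≤-reflexive (compFrom-tail-irrelevant u k∈u)
  ... | no  k∉u = subst₂ _≤_ (sym (compFrom-skip u k∉u)) (sym (compFrom-skip u k∉u))
                    (compFrom-++-mono us≤vs xs _)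

  span : Schedule n → ℕ
  span us = sum (map (unitLen I) us)

  compFrom-++-∉ : ∀ xs {us k t} → k ∉ jobsOf xs →
                  compFrom I t (xs ++ us) k ≡ compFrom I (t + span xs) us k
  compFrom-++-∉ []       {us} {k} {t} _  = cong (λ s → compFrom I s us k) (sym (+-identityʳ t))
  compFrom-++-∉ (u ∷ xs) {us} {k} {t} k∉ = begin
    compFrom I t (u ∷ xs ++ us) k                 ≡⟨ compFrom-skip u (k∉ ∘ ∈-jobsOf-∷ ∘ ∈-++⁺ˡ) ⟩
    compFrom I (t + unitLen I u) (xs ++ us) k     ≡⟨ compFrom-++-∉ xs (k∉ ∘ ∈-jobsOf-∷ ∘ ∈-++⁺ʳ _) ⟩
    compFrom I (t + unitLen I u + span xs) us k   ≡⟨ cong (λ s → compFrom I s us k) (+-assoc t _ _) ⟩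
    compFrom I (t + span (u ∷ xs)) us k           ∎
    where
    open ≡-Reasoning
    ∈-jobsOf-∷ : k ∈ jobsOf [ u ] ++ jobsOf xs → k ∈ jobsOf (u ∷ xs)
    ∈-jobsOf-∷ = subst (k ∈_) (sym (jobsOf-++ [ u ] xs))

  compFrom-pair≤singles : ∀ {i j k t} ys → i ≢ k →
    compFrom I t (pair j i ∷ ys) k ≤ compFrom I t (single i ∷ single j ∷ ys) k
  compFrom-pair≤singles {i} {j} {k} {t} ys i≢k with i ≟ k
  ... | yes i≡k = contradiction i≡k i≢k
  ... | no  _   with j ≟ k
  ...   | yes _ = +-monoˡ-≤ (b I j) (+-monoˡ-≤ (p I) (+-monoˡ-≤ (p I) (m≤m+n t _)))
  ...   | no  _ = compFrom-mono ys k (pair-ends-earlier t (p I) (b I i) (b I j))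

  compFrom-pair-snd≤singles-snd : ∀ {i j t} ys → i ≢ j →
    compFrom I t (pair j i ∷ ys) i ≤ compFrom I t (single i ∷ single j ∷ ys) j
  compFrom-pair-snd≤singles-snd {i} {j} {t} ys i≢j with j ≟ i | i ≟ i
  ... | yes j≡i | _       = contradiction (sym j≡i) i≢j
  ... | no  _   | no  i≢i = contradiction refl i≢i
  ... | no  _   | yes _   with i ≟ j
  ...   | yes i≡j = contradiction i≡j i≢j
  ...   | no  _   with j ≟ j
  ...     | yes _   = pair-snd-ends-earlier t (p I) (b I i) (b I j)
  ...     | no  j≢j = contradiction refl j≢j

  slack : Fin n → ℕ
  slack k = maxᶠ (d I) ∸ d I k

  cost : Schedule n → Fin n → ℕ
  cost σ k = C I σ k + slack k

  -- Lmax σ + max_k d_k: shifting by the largest due date keeps the objective in ℕ.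
  Lmax⁺ : Schedule n → ℕ
  Lmax⁺ σ = maxᶠ (cost σ)

  Lmax⁺-≤⇒LmaxLE : ∀ {σ σ'} → Lmax⁺ σ ≤ Lmax⁺ σ' → LmaxLE I σ σ'
  Lmax⁺-≤⇒LmaxLE {σ} {σ'} σ≤σ' j with maxᶠ-attained (cost σ') j
  ... | k , Lmax⁺σ'≤cost-k =
    k , +-exchange {C I σ j} {C I σ' k} {slack j} {slack k}
                   (trans (slack+d j) (sym (slack+d k)))
                   (≤-trans (f≤maxᶠ (cost σ) j) (≤-trans σ≤σ' Lmax⁺σ'≤cost-k))
    where
    slack+d : ∀ k → slack k + d I k ≡ maxᶠ (d I)
    slack+d k = m∸n+n≡m (f≤maxᶠ (d I) k)

  unitOK? : Decidable (UnitOK I)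
  unitOK? (single _) = yes tt
  unitOK? (pair i _) = b I i ≤? p I

  feasible? : Decidable (Feasible I)
  feasible? σ = (jobsOf σ ↭? allFin n) ×-dec all? unitOK? σ

  Feasible⇒Unique : ∀ {σ} → Feasible I σ → Unique (jobsOf σ)
  Feasible⇒Unique (jobs↭ , _) =
    Permutationₛ.Unique-resp-↭ (setoid (Fin n)) (↭⇒↭ₛ (↭-sym jobs↭)) (allFin⁺ n)

  Feasible⇒∈schedules : ∀ {σ} → Feasible I σ → σ ∈ schedules
  Feasible⇒∈schedules {σ} (jobs↭ , _) = ∈-listsUpTo units (All.tabulate (λ {u} _ → ∈-units u))
    (≤-trans (length≤length-jobsOf σ) (≤-reflexive (trans (↭-length jobs↭) (length-tabulate (λ k → k)))))

  singletons-feasible : Feasible I (map single (allFin n))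
  singletons-feasible =
      ↭-reflexive (jobsOf-map-single (allFin n))
    , All.map⁺ (All.universal (λ _ → tt) (allFin n))

  Feasible-replace : ∀ xs us vs ys → jobsOf vs ↭ jobsOf us → All (UnitOK I) vs →
                     Feasible I (xs ++ us ++ ys) → Feasible I (xs ++ vs ++ ys)
  Feasible-replace xs us vs ys vs↭us vs-ok (jobs↭ , ok) = jobs↭′ , ok′
    where
    jobsOf-split : ∀ ws → jobsOf (xs ++ ws ++ ys) ≡ jobsOf xs ++ jobsOf ws ++ jobsOf ys
    jobsOf-split ws = trans (jobsOf-++ xs (ws ++ ys)) (cong (jobsOf xs ++_) (jobsOf-++ ws ys))
    jobs↭′ : jobsOf (xs ++ vs ++ ys) ↭ allFin n
    jobs↭′ = ↭-trans (↭-reflexive (jobsOf-split vs))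
             (↭-trans (++⁺ˡ (jobsOf xs) (++⁺ʳ (jobsOf ys) vs↭us))
             (↭-trans (↭-reflexive (sym (jobsOf-split us))) jobs↭))
    ok′ : All (UnitOK I) (xs ++ vs ++ ys)
    ok′ with All.++⁻ xs ok
    ... | ok-xs , ok-us++ys = All.++⁺ ok-xs (All.++⁺ vs-ok (proj₂ (All.++⁻ us ok-us++ys)))

  Agreeable⇒d≤ : Agreeable I → ∀ {i j} → b I j < b I i → d I j ≤ d I i
  Agreeable⇒d≤ agr {i} {j} bj<bi with Fin.≤-total j i
  ... | inj₁ j≤i = proj₁ (agr j i j≤i)
  ... | inj₂ i≤j = contradiction (proj₂ (agr i j i≤j)) (<⇒≱ bj<bi)

  pair-up : Agreeable I → ∀ {σ i j} → Feasible I σ → SingletonFollowedBy σ i j →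
            InT I i → b I j ≤ p I →
            ∃[ τ ] (Feasible I τ × Lmax⁺ τ ≤ Lmax⁺ σ × length τ < length σ)
  pair-up agr {i = i} {j} feas (xs , ys , refl) p<bi bj≤p =
      τ
    , Feasible-replace xs (single i ∷ single j ∷ []) (pair j i ∷ []) ys
                       (swap j i ↭-refl) (bj≤p ∷ []) feas
    , maxᶠ≤ cost-bound
    , subst₂ _<_ (sym (length-++ xs)) (sym (length-++ xs)) (+-monoʳ-< (length xs) (n<1+n _))
    where
    σ = xs ++ single i ∷ single j ∷ ys
    τ = xs ++ pair j i ∷ ys
    bj<bi : b I j < b I i
    bj<bi = ≤-<-trans bj≤p p<bi
    i≢j : i ≢ j
    i≢j refl = <⇒≢ bj<bi refl
    unique : Unique (jobsOf xs ++ i ∷ j ∷ jobsOf ys)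
    unique = subst Unique (jobsOf-++ xs _) (Feasible⇒Unique feas)
    i∉xs : i ∉ jobsOf xs
    i∉xs = Unique-++⇒∉ (jobsOf xs) unique (here refl)
    j∉xs : j ∉ jobsOf xs
    j∉xs = Unique-++⇒∉ (jobsOf xs) unique (there (here refl))
    C-i≤C-j : C I τ i ≤ C I σ j
    C-i≤C-j = begin
      C I τ i                                               ≡⟨ compFrom-++-∉ xs i∉xs ⟩
      compFrom I (0 + span xs) (pair j i ∷ ys) i            ≤⟨ compFrom-pair-snd≤singles-snd ys i≢j ⟩
      compFrom I (0 + span xs) (single i ∷ single j ∷ ys) j ≡⟨ compFrom-++-∉ xs j∉xs ⟨
      C I σ j                                               ∎
      where open ≤-Reasoning
    cost-bound : ∀ k → cost τ k ≤ Lmax⁺ σ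
    cost-bound k with i ≟ k
    ... | yes refl = ≤-trans (+-mono-≤ C-i≤C-j (∸-monoʳ-≤ _ (Agreeable⇒d≤ agr bj<bi)))
                             (f≤maxᶠ (cost σ) j)
    ... | no  i≢k  = ≤-trans (+-monoˡ-≤ (slack k)
                               (compFrom-++-mono (λ _ → compFrom-pair≤singles ys i≢k) xs 0))
                             (f≤maxᶠ (cost σ) k)

  ∃-optimal : ∃[ σ₁ ] (Feasible I σ₁ × ∀ {σ} → Feasible I σ → Lmax⁺ σ₁ ≤ Lmax⁺ σ)
  ∃-optimal = ∃-argmin feasible? Lmax⁺ schedules Feasible⇒∈schedules singletons-feasible

  ∃-optimal-fewest-units :
    ∃[ σ ] (Feasible I σ × (∀ {σ′} → Feasible I σ′ → Lmax⁺ σ ≤ Lmax⁺ σ′)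
                         × (∀ {τ} → Feasible I τ → Lmax⁺ τ ≤ Lmax⁺ σ → length σ ≤ length τ))
  ∃-optimal-fewest-units =
    let σ₁ , feas₁ , σ₁-optimal = ∃-optimal
        σ , (feas , σ≤σ₁) , σ-fewest =
          ∃-argmin {P = λ σ → Feasible I σ × Lmax⁺ σ ≤ Lmax⁺ σ₁}
                   (λ σ → feasible? σ ×-dec (Lmax⁺ σ ≤? Lmax⁺ σ₁)) length schedules
                   (λ (feas , _) → Feasible⇒∈schedules feas) (feas₁ , ≤-refl)
    in  σ , feas
      , (λ feas′ → ≤-trans σ≤σ₁ (σ₁-optimal feas′))
      , (λ feasτ τ≤σ → σ-fewest (feasτ , ≤-trans τ≤σ σ≤σ₁))

  fewest-units⇒no-bad-singletons :
    Agreeable I → ∀ {σ} → Feasible I σ →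
    (∀ {τ} → Feasible I τ → Lmax⁺ τ ≤ Lmax⁺ σ → length σ ≤ length τ) →
    ∀ i j → SingletonFollowedBy σ i j → InT I i → InT I j
  fewest-units⇒no-bad-singletons agr feas fewest i j i→j p<bi with p I <? b I j
  ... | yes p<bj = p<bj
  ... | no  p≮bj =
    let τ , feasτ , τ≤σ , τ<σ = pair-up agr feas i→j p<bi (≮⇒≥ p≮bj)
    in  contradiction (fewest feasτ τ≤σ) (<⇒≱ τ<σ)

lemma6 : ∀ {n} (I : Instance n) → Agreeable I →
    ∃[ σ ] (Optimal I σ ×
      ((i j : Fin n) → SingletonFollowedBy σ i j → InT I i → InT I j))
lemma6 I agr =
  let σ , feas , σ-optimal , σ-fewest-units = ∃-optimal-fewest-units I
  in  σ , (feas , λ σ′ feas′ → Lmax⁺-≤⇒LmaxLE I {σ} {σ′} (σ-optimal feas′))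
        , fewest-units⇒no-bad-singletons I agr feas σ-fewest-units
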